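{- Let $b\ge3$, $d\ge1$, and let $a_1,\dots,a_{d-1}$ be positive integers coprime to $b$. For every $t\in\mathbb{Z}$, \[\frac{1}{\phi(b)}\sum_{\substack{1\le m\le b-1\\ \gcd(m,b)=1}}S_{(a_1,\dots,a_{d-1},m;b)}(t)=\frac12 S_{(a_1,\dots,a_{d-1};b)}(t),\] and \[\left(\frac{1}{\phi(b)}\right)^d\sum_{\substack{1\le m_1,\dots,m_d\le b-1\\ \gcd(m_i,b)=1}}S_{(m_1,\dots,m_d;b)}(t)=\frac{1}{2^d}S_b(t)=\frac{\delta_{\mathbb{Z}}(t/b)-\frac1b}{2^d}.\]
   Context: $\phi$ is Euler's totient function, $\xi_b=e^{2\pi i/b}$, $S_{(c_1,\dots,c_k;b)}(n)=\frac1b\sum_{j=1}^{b-1}\frac{\xi_b^{jn}}{(1-\xi_b^{jc_1})\cdots(1-\xi_b^{jc_k})}$, and for $k=0$ this is $S_b(n)=\frac1b\sum_{j=1}^{b-1}\xi_b^{jn}$. $\delta_{\mathbb{Z}}(x)=1$ if $x\in\mathbb{Z}$ and $0$ otherwise. -}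

module Defs where

open import Level using (Level; _⊔_) renaming (suc to lsuc)
open import Algebra.Bundles using (CommutativeRing; Semiring)
import Algebra.Definitions.RawSemiring as RS
open import Data.Nat as ℕ using (ℕ; zero; suc; _∸_; _≤_; _<_)
open import Data.Nat.GCD using (gcd)
import Data.Nat.Divisibility as ℕD
open import Data.Integer as ℤ using (ℤ; +_; -[1+_]; ∣_∣)
open import Data.List using (List; []; _∷_; applyUpTo; filter; length; foldr; map)
open import Relation.Nullary using (¬_; yes; no)

-- A field of characteristic zero, presented (constructively) as a commutative
-- ring with a total inverse operation that is a genuine inverse on nonzero
-- elements, and in which n·1 ≠ 0 for every n ≥ 1 (hence also 1 ≠ 0).
record CharZeroField c ℓ : Set (lsuc (c ⊔ ℓ)) where
  field
    commRing : CommutativeRing c ℓ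
  open CommutativeRing commRing public
  open RS (Semiring.rawSemiring semiring) public using (_^_)
  open RS (Semiring.rawSemiring semiring) using (_×_)
  field
    _⁻¹      : Carrier → Carrier
    inverseʳ : ∀ x → ¬ (x ≈ 0#) → (x * x ⁻¹) ≈ 1#
    charZero : ∀ n → ¬ ((suc n × 1#) ≈ 0#)

module FourierDedekind {c ℓ} (F : CharZeroField c ℓ) where
  open CharZeroField F

  IsPrimitiveRoot : Carrier → ℕ → Set ℓ
  IsPrimitiveRoot ξ b = ((ξ ^ b) ≈ 1#) Data.Product.× (∀ k → 1 ≤ k → k < b → ¬ ((ξ ^ k) ≈ 1#))
    where import Data.Product

  ipow : Carrier → ℤ → Carrier
  ipow x (+ n)     = x ^ n
  ipow x -[1+ n ] = (x ⁻¹) ^ suc n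

  Σ[_]_ : List ℕ → (ℕ → Carrier) → Carrier
  Σ[ xs ] f = foldr (λ x acc → f x + acc) 0# xs

  Π[_]_ : List ℕ → (ℕ → Carrier) → Carrier
  Π[ xs ] f = foldr (λ x acc → f x * acc) 1# xs

  ι : ℕ → Carrier
  ι n = n × 1#
    where open RS (Semiring.rawSemiring semiring) using (_×_)

  -- Fourier–Dedekind sum S_{(c_1,…,c_k; b)}(t), with ξ = ξ_b:
  --  (1/b) Σ_{j=1}^{b-1} ξ^{jt} / ((1-ξ^{j c_1})⋯(1-ξ^{j c_k}));  cs = [] gives S_b(t)
  S : (ξ : Carrier) (cs : List ℕ) (b : ℕ) (t : ℤ) → Carrier
  S ξ cs b t =
    ι b ⁻¹ * (Σ[ applyUpTo suc (b ∸ 1) ] λ j →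
                ipow ξ (+ j ℤ.* t) * Π[ cs ] (λ cᵢ → (1# - ξ ^ (j ℕ.* cᵢ)) ⁻¹))

  sumTuples : List ℕ → ℕ → (List ℕ → Carrier) → Carrier
  sumTuples ms zero    f = f []
  sumTuples ms (suc d) f = Σ[ ms ] λ m → sumTuples ms d (λ rest → f (m ∷ rest))

  δℤ : ℤ → ℕ → Carrier
  δℤ t b with b ℕD.∣? ∣ t ∣
  ... | yes _ = 1#
  ... | no  _ = 0#

unitsBelow : ℕ → List ℕ
unitsBelow b = filter (λ m → gcd m b ℕ.≟ 1) (applyUpTo suc (b ∸ 1))

φ : ℕ → ℕ
φ b = length (filter (λ m → gcd m b ℕ.≟ 1) (applyUpTo suc b))

module Submission where

-- Everything rests on
-- one identity: for 1 ≤ j < b,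
--     Σ_{m ∈ U} 1/(1 - ξ^{jm}) = φ(b)/2,     U = { 1 ≤ m < b : gcd(m,b) = 1 },
-- obtained by pairing m with b - m (also in U): since ξ^{jm} ξ^{j(b-m)} = 1 and both differ
-- from 1, the two reciprocals add up to 1.  Summing S(cs, m₁, …, m_d) over m₁, …, m_d ∈ U,
-- the product over the new parameters factors into (Σ_{m ∈ U} 1/(1 - ξ^{jm}))^d = (φ(b)/2)^d,
-- which does not depend on j; this gives both averaging identities (d = 1 with arbitrary
-- cs, and cs empty with d arbitrary).  The last identity S_b(t) = δ_ℤ(t/b) - 1/b is the
-- geometric sum of the b-th root of unity ξ^t.

open import Defs
open import Data.Nat as ℕ using (ℕ; zero; suc; _≤_; _<_; _∸_; z≤n; s≤s) renaming (_^_ to _^ℕ_)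
import Data.Nat.Properties as ℕP
open import Data.Nat.Divisibility using (_∣_; _∣?_; divides; ∣⇒≤; ∣m+n∣m⇒∣n; ∣-refl; m∣m*n; m%n≡0⇒n∣m)
open import Data.Nat.DivMod using (_%_; _/_; m≡m%n+[m/n]*n; m%n<n)
open import Data.Nat.Coprimality as Coprimality
  using (Coprime; coprime-divisor; gcd≡1⇒coprime; coprime⇒gcd≡1)
open import Data.Nat.GCD using (gcd; gcd-zeroˡ)
open import Data.Integer as ℤ using (ℤ)
import Data.Integer.Properties as ℤP
open import Data.List using (List; []; _∷_; _++_; applyUpTo; filter; length)
import Data.List.Properties as ListP
import Data.List.Relation.Unary.All as ListAll
open import Data.List.Relation.Unary.All.Properties using (applyUpTo⁺₁)
open import Data.Vec using (Vec; toList)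
open import Data.Vec.Relation.Unary.All using (All)
open import Data.Product using (_×_; _,_; proj₁; proj₂)
open import Data.Empty using (⊥-elim)
open import Function using (_∘_)
open import Relation.Nullary using (¬_; yes; no)
open import Relation.Unary using (Decidable)
open import Relation.Binary.PropositionalEquality as ≡ using (_≡_)
import Relation.Binary.Reasoning.Setoid as SetoidReasoning
import Algebra.Properties.Ring as RingProperties
import Algebra.Properties.Semiring.Exp as ExpProperties
import Algebra.Properties.CommutativeSemiring.Exp as CommExpProperties
import Algebra.Properties.Semiring.Mult as MultProperties
import Algebra.Solver.CommutativeMonoid as CommutativeMonoidSolver

module FieldFacts {c ℓ} (F : CharZeroField c ℓ) where
  open CharZeroField F hiding (zero)
  open FourierDedekind F using (ι; ipow)
  open SetoidReasoning setoid
  open ExpProperties semiring public using (^-congˡ; ^-congʳ; ^-homo-*; ^-assocʳ)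
  open CommExpProperties commutativeSemiring public using (^-distrib-*)
  open RingProperties ring public using (-‿distribˡ-*; -‿distribʳ-*; -‿involutive; -‿+-comm)

  module *-Solver = CommutativeMonoidSolver *-commutativeMonoid
  module +-Solver = CommutativeMonoidSolver +-commutativeMonoid

  1≉0 : ¬ 1# ≈ 0#
  1≉0 1≈0 = charZero 0 (trans (+-identityʳ 1#) 1≈0)

  ι≉0 : ∀ {n} → 0 < n → ¬ ι n ≈ 0#
  ι≉0 {suc n} _ = charZero n

  -- ι is multiplicative, hence commutes with powers.
  ι-homo-^ : ∀ m n → ι (m ^ℕ n) ≈ ι m ^ n
  ι-homo-^ m zero    = +-identityʳ 1#
  ι-homo-^ m (suc n) = trans (MultProperties.×1-homo-* semiring m (m ^ℕ n)) (*-congˡ (ι-homo-^ m n))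

  ι2*x≈x+x : ∀ x → ι 2 * x ≈ x + x
  ι2*x≈x+x x = begin
    (1# + (1# + 0#)) * x     ≈⟨ *-congʳ (+-congˡ (+-identityʳ 1#)) ⟩
    (1# + 1#) * x            ≈⟨ distribʳ x 1# 1# ⟩
    1# * x + 1# * x          ≈⟨ +-cong (*-identityˡ x) (*-identityˡ x) ⟩
    x + x                    ∎

  1^n≈1 : ∀ n → 1# ^ n ≈ 1#
  1^n≈1 zero    = refl
  1^n≈1 (suc n) = trans (*-identityˡ _) (1^n≈1 n)

  solve-for : ∀ {a c d} → a + c ≈ d → c ≈ d - a
  solve-for {a} {c} {d} a+c≈d = begin
    c                ≈⟨ sym (+-identityʳ c) ⟩
    c + 0#           ≈⟨ +-congˡ (sym (-‿inverseʳ a)) ⟩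
    c + (a - a)      ≈⟨ sym (+-assoc c a (- a)) ⟩
    (c + a) - a      ≈⟨ +-congʳ (trans (+-comm c a) a+c≈d) ⟩
    d - a            ∎

  difference≈0 : ∀ {a c} → a - c ≈ 0# → a ≈ c
  difference≈0 {a} {c} a-c≈0 = begin
    a                ≈⟨ solve-for (trans (+-comm (- c) a) a-c≈0) ⟩
    0# - - c         ≈⟨ +-identityˡ (- (- c)) ⟩
    - - c            ≈⟨ -‿involutive c ⟩
    c                ∎

  inverseˡ : ∀ x → ¬ x ≈ 0# → x ⁻¹ * x ≈ 1#
  inverseˡ x x≉0 = trans (*-comm (x ⁻¹) x) (inverseʳ x x≉0)

  cancelˡ : ∀ {x} y → ¬ x ≈ 0# → x ⁻¹ * (x * y) ≈ y
  cancelˡ {x} y x≉0 = begin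
    x ⁻¹ * (x * y)   ≈⟨ sym (*-assoc (x ⁻¹) x y) ⟩
    (x ⁻¹ * x) * y   ≈⟨ *-congʳ (inverseˡ x x≉0) ⟩
    1# * y           ≈⟨ *-identityˡ y ⟩
    y                ∎

  no-zero-divisors : ∀ {x y} → ¬ x ≈ 0# → x * y ≈ 0# → y ≈ 0#
  no-zero-divisors {x} {y} x≉0 xy≈0 =
    trans (sym (cancelˡ y x≉0)) (trans (*-congˡ xy≈0) (zeroʳ (x ⁻¹)))

  inverse-unique : ∀ {x y} → ¬ x ≈ 0# → x * y ≈ 1# → y ≈ x ⁻¹
  inverse-unique {x} {y} x≉0 xy≈1 =
    trans (sym (cancelˡ y x≉0)) (trans (*-congˡ xy≈1) (*-identityʳ (x ⁻¹)))

  ⁻¹-cong : ∀ {x y} → ¬ x ≈ 0# → x ≈ y → x ⁻¹ ≈ y ⁻¹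
  ⁻¹-cong {x} {y} x≉0 x≈y =
    inverse-unique (λ y≈0 → x≉0 (trans x≈y y≈0)) (trans (*-congʳ (sym x≈y)) (inverseʳ x x≉0))

  ^≉0 : ∀ {x} n → ¬ x ≈ 0# → ¬ x ^ n ≈ 0#
  ^≉0 zero    x≉0 = 1≉0
  ^≉0 (suc n) x≉0 = ^≉0 n x≉0 ∘ no-zero-divisors x≉0

  pow-inverse : ∀ {x} n → ¬ x ≈ 0# → x ^ n * (x ⁻¹) ^ n ≈ 1#
  pow-inverse {x} n x≉0 = begin
    x ^ n * (x ⁻¹) ^ n   ≈⟨ sym (^-distrib-* x (x ⁻¹) n) ⟩
    (x * x ⁻¹) ^ n       ≈⟨ ^-congˡ n (inverseʳ x x≉0) ⟩
    1# ^ n               ≈⟨ 1^n≈1 n ⟩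
    1#                   ∎

  inverse-^ : ∀ {x} n → ¬ x ≈ 0# → (x ⁻¹) ^ n ≈ (x ^ n) ⁻¹
  inverse-^ n x≉0 = inverse-unique (^≉0 n x≉0) (pow-inverse n x≉0)

  unit-partner : ∀ {a c} → a * c ≈ 1# → a ≈ 1# → c ≈ 1#
  unit-partner {a} {c} ac≈1 a≈1 = trans (sym (*-identityˡ c)) (trans (*-congʳ (sym a≈1)) ac≈1)

  -- The key algebraic identity behind the averaging: if xy = 1 with x, y ≠ 1 then
  -- 1/(1-x) + 1/(1-y) = 1, because (1-x)(1-y) = (1-x) + (1-y) when xy = 1.
  reciprocal-pair : ∀ {x y} → x * y ≈ 1# → ¬ x ≈ 1# → ¬ y ≈ 1# →
                    (1# - x) ⁻¹ + (1# - y) ⁻¹ ≈ 1#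
  reciprocal-pair {x} {y} xy≈1 x≉1 y≉1 = begin
    u ⁻¹ + v ⁻¹                              ≈⟨ +-cong (sym (*-identityˡ (u ⁻¹))) (sym (*-identityˡ (v ⁻¹))) ⟩
    1# * u ⁻¹ + 1# * v ⁻¹                    ≈⟨ +-cong (*-congʳ (sym (inverseʳ v v≉0))) (*-congʳ (sym (inverseʳ u u≉0))) ⟩
    (v * v ⁻¹) * u ⁻¹ + (u * u ⁻¹) * v ⁻¹    ≈⟨ +-comm _ _ ⟩
    (u * u ⁻¹) * v ⁻¹ + (v * v ⁻¹) * u ⁻¹    ≈⟨ +-cong (*-assoc u (u ⁻¹) (v ⁻¹))
                                                   (*-Solver.solve 3 (λ v v' u' → (v ⊕ v') ⊕ u' ⊜ v ⊕ (u' ⊕ v'))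
                                                      refl v (v ⁻¹) (u ⁻¹)) ⟩
    u * (u ⁻¹ * v ⁻¹) + v * (u ⁻¹ * v ⁻¹)    ≈⟨ sym (distribʳ (u ⁻¹ * v ⁻¹) u v) ⟩
    (u + v) * (u ⁻¹ * v ⁻¹)                  ≈⟨ *-congʳ (sym uv≈u+v) ⟩
    (u * v) * (u ⁻¹ * v ⁻¹)                  ≈⟨ *-Solver.solve 4 (λ u v u' v' →
                                                  (u ⊕ v) ⊕ (u' ⊕ v') ⊜ (u ⊕ u') ⊕ (v ⊕ v'))
                                                  refl u v (u ⁻¹) (v ⁻¹) ⟩
    (u * u ⁻¹) * (v * v ⁻¹)                  ≈⟨ *-cong (inverseʳ u u≉0) (inverseʳ v v≉0) ⟩
    1# * 1#                                  ≈⟨ *-identityˡ 1# ⟩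
    1#                                       ∎
    where
    open *-Solver using (_⊕_; _⊜_)
    u = 1# - x
    v = 1# - y
    u≉0 : ¬ u ≈ 0#
    u≉0 = x≉1 ∘ sym ∘ difference≈0
    v≉0 : ¬ v ≈ 0#
    v≉0 = y≉1 ∘ sym ∘ difference≈0
    xv≈x-1 : x * v ≈ x - 1#
    xv≈x-1 = begin
      x * (1# - y)        ≈⟨ distribˡ x 1# (- y) ⟩
      x * 1# + x * - y    ≈⟨ +-cong (*-identityʳ x) (sym (-‿distribʳ-* x y)) ⟩
      x - x * y           ≈⟨ +-congˡ (-‿cong xy≈1) ⟩
      x - 1#              ∎
    uv≈u+v : u * v ≈ u + v
    uv≈u+v = begin
      (1# - x) * v        ≈⟨ distribʳ v 1# (- x) ⟩
      1# * v + - x * v    ≈⟨ +-cong (*-identityˡ v) (sym (-‿distribˡ-* x v)) ⟩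
      v - x * v           ≈⟨ +-congˡ (-‿cong xv≈x-1) ⟩
      v - (x - 1#)        ≈⟨ +-congˡ (sym (-‿+-comm x (- 1#))) ⟩
      v + (- x + - - 1#)  ≈⟨ +-congˡ (+-congˡ (-‿involutive 1#)) ⟩
      v + (- x + 1#)      ≈⟨ +-comm v (- x + 1#) ⟩
      (- x + 1#) + v      ≈⟨ +-congʳ (+-comm (- x) 1#) ⟩
      u + v               ∎

  pow-swap : ∀ x j n → x ^ (j ℕ.* n) ≈ (x ^ n) ^ j
  pow-swap x j n = trans (^-congʳ x (ℕP.*-comm j n)) (sym (^-assocʳ x n j))

  ipow-*ˡ : ∀ x j t → ipow x (ℤ.+ j ℤ.* t) ≈ ipow x t ^ j
  ipow-*ˡ x j (ℤ.+ n)    = trans (reflexive (≡.cong (ipow x) (≡.sym (ℤP.pos-* j n)))) (pow-swap x j n)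
  ipow-*ˡ x j ℤ.-[1+ n ] = trans (reflexive (≡.cong (ipow x) jt≡-[j*n])) (trans (ipow-negate (j ℕ.* suc n))
                                 (pow-swap (x ⁻¹) j (suc n)))
    where
    jt≡-[j*n] : ℤ.+ j ℤ.* ℤ.-[1+ n ] ≡ ℤ.- (ℤ.+ (j ℕ.* suc n))
    jt≡-[j*n] = ≡.trans (≡.sym (ℤP.neg-distribʳ-* (ℤ.+ j) (ℤ.+ suc n)))
                        (≡.cong ℤ.-_ (≡.sym (ℤP.pos-* j (suc n))))
    ipow-negate : ∀ k → ipow x (ℤ.- (ℤ.+ k)) ≈ (x ⁻¹) ^ k
    ipow-negate zero    = refl
    ipow-negate (suc k) = refl

module BigOperators {c ℓ} (F : CharZeroField c ℓ) where
  open CharZeroField F hiding (zero)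
  open FourierDedekind F
  open FieldFacts F
  open SetoidReasoning setoid

  Σ-congᴬ : ∀ {xs} {f g : ℕ → Carrier} → ListAll.All (λ x → f x ≈ g x) xs → Σ[ xs ] f ≈ Σ[ xs ] g
  Σ-congᴬ ListAll.[]         = refl
  Σ-congᴬ (fx≈gx ListAll.∷ e) = +-cong fx≈gx (Σ-congᴬ e)

  Σ-cong : ∀ xs {f g : ℕ → Carrier} → (∀ x → f x ≈ g x) → Σ[ xs ] f ≈ Σ[ xs ] g
  Σ-cong xs f≈g = Σ-congᴬ (ListAll.universal f≈g xs)

  Σ-0 : ∀ xs → Σ[ xs ] (λ _ → 0#) ≈ 0#
  Σ-0 []       = refl
  Σ-0 (x ∷ xs) = trans (+-identityˡ _) (Σ-0 xs)

  Σ-1 : ∀ xs → Σ[ xs ] (λ _ → 1#) ≈ ι (length xs)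
  Σ-1 []       = refl
  Σ-1 (x ∷ xs) = +-congˡ (Σ-1 xs)

  Σ-+ : ∀ xs (f g : ℕ → Carrier) → Σ[ xs ] (λ x → f x + g x) ≈ Σ[ xs ] f + Σ[ xs ] g
  Σ-+ []       f g = sym (+-identityʳ 0#)
  Σ-+ (x ∷ xs) f g = trans (+-congˡ (Σ-+ xs f g))
    (+-Solver.solve 4 (λ a b c d → (a ⊕ b) ⊕ (c ⊕ d) ⊜ (a ⊕ c) ⊕ (b ⊕ d)) refl (f x) (g x) _ _)
    where open +-Solver using (_⊕_; _⊜_)

  Σ-*ˡ : ∀ xs k (f : ℕ → Carrier) → Σ[ xs ] (λ x → k * f x) ≈ k * Σ[ xs ] f
  Σ-*ˡ []       k f = sym (zeroʳ k)
  Σ-*ˡ (x ∷ xs) k f = trans (+-congˡ (Σ-*ˡ xs k f)) (sym (distribˡ k _ _))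

  Σ-*ʳ : ∀ xs k (f : ℕ → Carrier) → Σ[ xs ] (λ x → f x * k) ≈ Σ[ xs ] f * k
  Σ-*ʳ xs k f = trans (Σ-cong xs (λ x → *-comm (f x) k)) (trans (Σ-*ˡ xs k f) (*-comm k _))

  Σ-swap : ∀ xs ys (h : ℕ → ℕ → Carrier) →
           Σ[ xs ] (λ x → Σ[ ys ] (h x)) ≈ Σ[ ys ] (λ y → Σ[ xs ] (λ x → h x y))
  Σ-swap []       ys h = sym (Σ-0 ys)
  Σ-swap (x ∷ xs) ys h = trans (+-congˡ (Σ-swap xs ys h)) (sym (Σ-+ ys (h x) _))

  Σ-++ : ∀ xs ys (f : ℕ → Carrier) → Σ[ xs ++ ys ] f ≈ Σ[ xs ] f + Σ[ ys ] f
  Σ-++ []       ys f = sym (+-identityˡ _)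
  Σ-++ (x ∷ xs) ys f = trans (+-congˡ (Σ-++ xs ys f)) (sym (+-assoc _ _ _))

  Σ-applyUpTo-∘ : ∀ (s f : ℕ → ℕ) n (h : ℕ → Carrier) →
                  Σ[ applyUpTo (s ∘ f) n ] h ≡ Σ[ applyUpTo f n ] (h ∘ s)
  Σ-applyUpTo-∘ s f zero    h = ≡.refl
  Σ-applyUpTo-∘ s f (suc n) h = ≡.cong (h (s (f 0)) +_) (Σ-applyUpTo-∘ s (f ∘ suc) n h)

  Σ-snoc : ∀ (f : ℕ → ℕ) n (h : ℕ → Carrier) →
           Σ[ applyUpTo f (suc n) ] h ≈ Σ[ applyUpTo f n ] h + h (f n)
  Σ-snoc f n h = begin
    Σ[ applyUpTo f (suc n) ] h            ≡⟨ ≡.cong (Σ[_] h) (≡.sym (ListP.applyUpTo-∷ʳ f n)) ⟩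
    Σ[ applyUpTo f n ++ f n ∷ [] ] h      ≈⟨ Σ-++ (applyUpTo f n) _ h ⟩
    Σ[ applyUpTo f n ] h + (h (f n) + 0#) ≈⟨ +-congˡ (+-identityʳ _) ⟩
    Σ[ applyUpTo f n ] h + h (f n)        ∎

  Σ-reflect : ∀ n (h : ℕ → Carrier) →
              Σ[ applyUpTo suc n ] h ≈ Σ[ applyUpTo suc n ] (λ m → h (suc n ∸ m))
  Σ-reflect zero    h = refl
  Σ-reflect (suc n) h = begin
    Σ[ applyUpTo suc (suc n) ] h                             ≈⟨ Σ-snoc suc n h ⟩
    Σ[ applyUpTo suc n ] h + h (suc n)                       ≈⟨ +-congʳ (Σ-reflect n h) ⟩
    Σ[ applyUpTo suc n ] (λ m → h (suc n ∸ m)) + h (suc n)   ≈⟨ +-comm _ _ ⟩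
    h (suc n) + Σ[ applyUpTo suc n ] (λ m → h (suc n ∸ m))   ≡⟨ ≡.cong (h (suc n) +_)
                                                                  (≡.sym (Σ-applyUpTo-∘ suc suc n _)) ⟩
    Σ[ applyUpTo suc (suc n) ] (λ m → h (suc (suc n) ∸ m))   ∎

  -- Σ_{j=1}^{n} ζʲ = -1 for an (n+1)-th root of unity ζ ≠ 1: with E = Σ_{j=0}^{n} ζʲ
  -- one has ζE = E, hence (1 - ζ)E = 0 and E = 0.
  geometric-sum : ∀ n {ζ} → ζ ^ suc n ≈ 1# → ¬ ζ ≈ 1# → Σ[ applyUpTo suc n ] (ζ ^_) ≈ - 1#
  geometric-sum n {ζ} ζⁿ⁺¹≈1 ζ≉1 =
    trans (solve-for (trans (+-comm 1# Σζ) E≈0)) (+-identityˡ (- 1#))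
    where
    Σζ = Σ[ applyUpTo suc n ] (ζ ^_)
    E = Σζ + 1#
    ζE≈E : ζ * E ≈ E
    ζE≈E = begin
      ζ * (Σζ + 1#)                                  ≈⟨ trans (distribˡ ζ Σζ 1#) (+-comm _ _) ⟩
      ζ * 1# + ζ * Σζ                                ≈⟨ +-congˡ (sym (Σ-*ˡ (applyUpTo suc n) ζ (ζ ^_))) ⟩
      ζ * 1# + Σ[ applyUpTo suc n ] (λ j → ζ ^ suc j) ≡⟨ ≡.cong (ζ * 1# +_) (≡.sym (Σ-applyUpTo-∘ suc suc n (ζ ^_))) ⟩
      Σ[ applyUpTo suc (suc n) ] (ζ ^_)              ≈⟨ Σ-snoc suc n (ζ ^_) ⟩
      Σζ + ζ ^ suc n                                 ≈⟨ +-congˡ ζⁿ⁺¹≈1 ⟩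
      E                                              ∎
    [1-ζ]E≈0 : (1# - ζ) * E ≈ 0#
    [1-ζ]E≈0 = begin
      (1# - ζ) * E           ≈⟨ distribʳ E 1# (- ζ) ⟩
      1# * E + - ζ * E       ≈⟨ +-cong (*-identityˡ E) (sym (-‿distribˡ-* ζ E)) ⟩
      E - ζ * E              ≈⟨ +-congˡ (-‿cong ζE≈E) ⟩
      E - E                  ≈⟨ -‿inverseʳ E ⟩
      0#                     ∎
    E≈0 : E ≈ 0#
    E≈0 = no-zero-divisors (ζ≉1 ∘ sym ∘ difference≈0) [1-ζ]E≈0

  restrict : ∀ {p} {P : ℕ → Set p} → Decidable P → (ℕ → Carrier) → ℕ → Carrier
  restrict P? h m with P? m
  ... | yes _ = h m
  ... | no  _ = 0#

  Σ-filter : ∀ {p} {P : ℕ → Set p} (P? : Decidable P) xs (h : ℕ → Carrier) →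
             Σ[ filter P? xs ] h ≈ Σ[ xs ] (restrict P? h)
  Σ-filter P? []       h = refl
  Σ-filter P? (x ∷ xs) h with P? x
  ... | yes _ = +-congˡ (Σ-filter P? xs h)
  ... | no  _ = trans (Σ-filter P? xs h) (sym (+-identityˡ _))

  -- Pairing m with n+1-m: if P is stable under this reflection and the two terms
  -- of every pair sum to 1, then twice the sum of h over {1 ≤ m ≤ n | P m} is the
  -- number of such m.
  Σ-reflection-pairing :
    ∀ n {p} {P : ℕ → Set p} (P? : Decidable P) (h : ℕ → Carrier) →
    (∀ m → m ≤ suc n → P m → P (suc n ∸ m)) →
    (∀ m → 1 ≤ m → m ≤ n → P m → h m + h (suc n ∸ m) ≈ 1#) →
    ι 2 * Σ[ filter P? (applyUpTo suc n) ] h ≈ ι (length (filter P? (applyUpTo suc n)))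
  Σ-reflection-pairing n {P = P} P? h reflect-closed pairs-to-1 = begin
    ι 2 * Σ[ A ] h                            ≈⟨ ι2*x≈x+x _ ⟩
    Σ[ A ] h + Σ[ A ] h                       ≈⟨ +-cong (Σ-filter P? L h)
                                                   (trans (Σ-filter P? L h) (Σ-reflect n (restrict P? h))) ⟩
    Σ[ L ] (restrict P? h) + Σ[ L ] (λ m → restrict P? h (suc n ∸ m))
                                              ≈⟨ sym (Σ-+ L _ _) ⟩
    Σ[ L ] (λ m → restrict P? h m + restrict P? h (suc n ∸ m))
                                              ≈⟨ Σ-congᴬ (applyUpTo⁺₁ suc n pair) ⟩
    Σ[ L ] (restrict P? (λ _ → 1#))           ≈⟨ sym (Σ-filter P? L _) ⟩
    Σ[ A ] (λ _ → 1#)                         ≈⟨ Σ-1 A ⟩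
    ι (length A)                              ∎
    where
    L = applyUpTo suc n
    A = filter P? L
    pair : ∀ {i} → i < n →
           restrict P? h (suc i) + restrict P? h (suc n ∸ suc i) ≈ restrict P? (λ _ → 1#) (suc i)
    pair {i} i<n with P? (suc i) | P? (suc n ∸ suc i)
    ... | yes Pm | yes _   = pairs-to-1 (suc i) (s≤s z≤n) i<n Pm
    ... | yes Pm | no ¬Pm' = ⊥-elim (¬Pm' (reflect-closed (suc i) (ℕP.m≤n⇒m≤1+n i<n) Pm))
    ... | no ¬Pm | yes Pm' = ⊥-elim (¬Pm (≡.subst P (ℕP.m∸[m∸n]≡n (ℕP.m≤n⇒m≤1+n i<n))
                                            (reflect-closed _ (ℕP.m∸n≤m (suc n) (suc i)) Pm')))
    ... | no _   | no _    = +-identityʳ 0#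

  Π-++ : ∀ xs ys (g : ℕ → Carrier) → Π[ xs ++ ys ] g ≈ Π[ xs ] g * Π[ ys ] g
  Π-++ []       ys g = sym (*-identityˡ _)
  Π-++ (x ∷ xs) ys g = trans (*-congˡ (Π-++ xs ys g)) (sym (*-assoc _ _ _))

  module _ (U : List ℕ) where

    sumTuples-cong : ∀ d {f g : List ℕ → Carrier} → (∀ ms → f ms ≈ g ms) →
                     sumTuples U d f ≈ sumTuples U d g
    sumTuples-cong zero    f≈g = f≈g []
    sumTuples-cong (suc d) f≈g = Σ-cong U (λ m → sumTuples-cong d (λ rest → f≈g (m ∷ rest)))

    sumTuples-*ˡ : ∀ d k (f : List ℕ → Carrier) →
                   sumTuples U d (λ ms → k * f ms) ≈ k * sumTuples U d f
    sumTuples-*ˡ zero    k f = refl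
    sumTuples-*ˡ (suc d) k f =
      trans (Σ-cong U (λ m → sumTuples-*ˡ d k (λ rest → f (m ∷ rest)))) (Σ-*ˡ U k _)

    sumTuples-Σ : ∀ d js (h : List ℕ → ℕ → Carrier) →
                  sumTuples U d (λ ms → Σ[ js ] (h ms)) ≈ Σ[ js ] (λ j → sumTuples U d (λ ms → h ms j))
    sumTuples-Σ zero    js h = refl
    sumTuples-Σ (suc d) js h =
      trans (Σ-cong U (λ m → sumTuples-Σ d js (λ rest → h (m ∷ rest)))) (Σ-swap U js _)

    sumTuples-Π : ∀ d k (g : ℕ → Carrier) →
                  sumTuples U d (λ ms → k * Π[ ms ] g) ≈ k * (Σ[ U ] g) ^ d
    sumTuples-Π zero    k g = refl
    sumTuples-Π (suc d) k g = begin
      Σ[ U ] (λ m → sumTuples U d (λ rest → k * (g m * Π[ rest ] g)))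
        ≈⟨ Σ-cong U (λ m → sumTuples-cong d (λ rest → sym (*-assoc k (g m) _))) ⟩
      Σ[ U ] (λ m → sumTuples U d (λ rest → (k * g m) * Π[ rest ] g))
        ≈⟨ Σ-cong U (λ m → sumTuples-Π d (k * g m) g) ⟩
      Σ[ U ] (λ m → (k * g m) * G ^ d)
        ≈⟨ Σ-cong U (λ m → *-Solver.solve 3 (λ k g G → (k ⊕ g) ⊕ G ⊜ (k ⊕ G) ⊕ g) refl k (g m) (G ^ d)) ⟩
      Σ[ U ] (λ m → (k * G ^ d) * g m)
        ≈⟨ Σ-*ˡ U _ g ⟩
      (k * G ^ d) * G
        ≈⟨ *-Solver.solve 3 (λ k G Gᵈ → (k ⊕ Gᵈ) ⊕ G ⊜ k ⊕ (G ⊕ Gᵈ)) refl k G (G ^ d) ⟩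
      k * (G * G ^ d) ∎
      where
      G = Σ[ U ] g
      open *-Solver using (_⊕_; _⊜_)

IsUnit : ℕ → ℕ → Set
IsUnit b m = gcd m b ≡ 1

unit? : ∀ b → Decidable (IsUnit b)
unit? b m = gcd m b ℕ.≟ 1

coprime-reflect : ∀ {b m} → m ≤ b → Coprime m b → Coprime (b ∸ m) b
coprime-reflect {b} m≤b coprime {i} (i∣b-m , i∣b) =
  coprime (∣m+n∣m⇒∣n (≡.subst (i ∣_) (≡.sym (ℕP.m∸n+n≡m m≤b)) i∣b) i∣b-m , i∣b)

unit-reflect : ∀ {b} m → m ≤ b → IsUnit b m → IsUnit b (b ∸ m)
unit-reflect m m≤b = coprime⇒gcd≡1 ∘ coprime-reflect m≤b ∘ gcd≡1⇒coprime

-- For b ≥ 2, b itself is not a unit, so φ(b) is the length of  unitsBelow b.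
φ≡length-unitsBelow : ∀ {b} → 2 ≤ b → φ b ≡ length (unitsBelow b)
φ≡length-unitsBelow {suc b'} 2≤b = begin
  length (filter (unit? b) (applyUpTo suc b))                  ≡⟨ ≡.cong (length ∘ filter (unit? b))
                                                                    (≡.sym (ListP.applyUpTo-∷ʳ suc b')) ⟩
  length (filter (unit? b) (L ++ b ∷ []))                      ≡⟨ ≡.cong length (ListP.filter-++ (unit? b) L (b ∷ [])) ⟩
  length (filter (unit? b) L ++ filter (unit? b) (b ∷ []))     ≡⟨ ≡.cong (λ l → length (filter (unit? b) L ++ l))
                                                                    (ListP.filter-reject (unit? b) {x = b} {xs = []} b-not-unit) ⟩
  length (filter (unit? b) L ++ [])                            ≡⟨ ≡.cong length (ListP.++-identityʳ (filter (unit? b) L)) ⟩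
  length (filter (unit? b) L)                                  ∎
  where
  open ≡.≡-Reasoning
  b = suc b'
  L = applyUpTo suc b'
  b-not-unit : ¬ IsUnit b b
  b-not-unit b-unit = ℕP.<⇒≢ 2≤b (≡.sym (gcd≡1⇒coprime b-unit (∣-refl , ∣-refl)))

-- 1 is always a unit.
φ-positive : ∀ {b} → 1 ≤ b → 0 < φ b
φ-positive {suc b'} _ = ≡.subst (0 <_)
  (≡.sym (≡.cong length (ListP.filter-accept (unit? (suc b')) {x = 1} {xs = applyUpTo (suc ∘ suc) b'} (gcd-zeroˡ (suc b')))))
  (s≤s z≤n)

module RootsOfUnity {c ℓ} (F : CharZeroField c ℓ) (ξ : CharZeroField.Carrier F) (b' : ℕ)
  (ξ-primitive : FourierDedekind.IsPrimitiveRoot F ξ (suc b')) where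
  open CharZeroField F hiding (zero)
  open FourierDedekind F
  open FieldFacts F
  open BigOperators F
  open SetoidReasoning setoid

  b : ℕ
  b = suc b'

  ξᵇ≈1 : ξ ^ b ≈ 1#
  ξᵇ≈1 = proj₁ ξ-primitive

  ξ≉0 : ¬ ξ ≈ 0#
  ξ≉0 ξ≈0 = 1≉0 (trans (sym ξᵇ≈1) (trans (*-congʳ ξ≈0) (zeroˡ _)))

  ∣⇒pow≈1 : ∀ {k} → b ∣ k → ξ ^ k ≈ 1#
  ∣⇒pow≈1 (divides q ≡.refl) = trans (pow-swap ξ q b) (trans (^-congˡ q ξᵇ≈1) (1^n≈1 q))

  -- Primitivity: ξᵏ = 1 only for multiples k of b (reduce k modulo b).
  pow≈1⇒∣ : ∀ k → ξ ^ k ≈ 1# → b ∣ k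
  pow≈1⇒∣ k ξᵏ≈1 with k % b ℕ.≟ 0
  ... | yes k%b≡0 = m%n≡0⇒n∣m k b k%b≡0
  ... | no  k%b≢0 = ⊥-elim (proj₂ ξ-primitive (k % b) (ℕP.n≢0⇒n>0 k%b≢0) (m%n<n k b) ξ^[k%b]≈1)
    where
    ξ^[k%b]≈1 : ξ ^ (k % b) ≈ 1#
    ξ^[k%b]≈1 = begin
      ξ ^ (k % b)                           ≈⟨ sym (*-identityʳ _) ⟩
      ξ ^ (k % b) * 1#                      ≈⟨ *-congˡ (sym (∣⇒pow≈1 (divides (k / b) ≡.refl))) ⟩
      ξ ^ (k % b) * ξ ^ ((k / b) ℕ.* b)     ≈⟨ sym (^-homo-* ξ (k % b) ((k / b) ℕ.* b)) ⟩
      ξ ^ (k % b ℕ.+ (k / b) ℕ.* b)         ≈⟨ ^-congʳ ξ (≡.sym (m≡m%n+[m/n]*n k b)) ⟩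
      ξ ^ k                                 ≈⟨ ξᵏ≈1 ⟩
      1#                                    ∎

  pow-coprime≉1 : ∀ {j m} → 1 ≤ j → j < b → Coprime m b → ¬ ξ ^ (j ℕ.* m) ≈ 1#
  pow-coprime≉1 {suc j} {m} _ j<b coprime ξʲᵐ≈1 = ℕP.<⇒≱ j<b (∣⇒≤ b∣j)
    where
    b∣j : b ∣ suc j
    b∣j = coprime-divisor (Coprimality.sym coprime)
            (≡.subst (b ∣_) (ℕP.*-comm (suc j) m) (pow≈1⇒∣ _ ξʲᵐ≈1))

  -- ξᵗ = 1 exactly when b divides t, for integer t; negative powers reduce to positive
  -- ones because ξᵏ (ξ⁻¹)ᵏ = 1.
  ∣⇒ipow≈1 : ∀ t → b ∣ ℤ.∣ t ∣ → ipow ξ t ≈ 1#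
  ∣⇒ipow≈1 (ℤ.+ n)    b∣t = ∣⇒pow≈1 b∣t
  ∣⇒ipow≈1 ℤ.-[1+ n ] b∣t = unit-partner (pow-inverse (suc n) ξ≉0) (∣⇒pow≈1 b∣t)

  ipow≈1⇒∣ : ∀ t → ipow ξ t ≈ 1# → b ∣ ℤ.∣ t ∣
  ipow≈1⇒∣ (ℤ.+ n)    ξᵗ≈1 = pow≈1⇒∣ n ξᵗ≈1
  ipow≈1⇒∣ ℤ.-[1+ n ] ξᵗ≈1 =
    pow≈1⇒∣ (suc n) (unit-partner (trans (*-comm _ _) (pow-inverse (suc n) ξ≉0)) ξᵗ≈1)

  ipow-root : ∀ t → ipow ξ t ^ b ≈ 1#
  ipow-root t = trans (sym (ipow-*ˡ ξ b t))
    (∣⇒ipow≈1 (ℤ.+ b ℤ.* t) (≡.subst (b ∣_) (≡.sym (ℤP.abs-* (ℤ.+ b) t)) (m∣m*n ℤ.∣ t ∣)))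

  -- S_b(t) = δ_ℤ(t/b) - 1/b: the sum Σ_{j=1}^{b-1} ξ^{jt} is b - 1 if b ∣ t, and -1 otherwise.
  S-empty : ∀ t → S ξ [] b t ≈ δℤ t b - ι b ⁻¹
  S-empty t with b ∣? ℤ.∣ t ∣
  ... | yes b∣t = begin
    w * Σ[ L ] (λ j → ipow ξ (ℤ.+ j ℤ.* t) * 1#)   ≈⟨ *-congˡ (Σ-cong L term≈1) ⟩
    w * Σ[ L ] (λ _ → 1#)                          ≈⟨ *-congˡ (Σ-1 L) ⟩
    w * ι (length L)                               ≡⟨ ≡.cong (λ n → w * ι n) (ListP.length-applyUpTo suc b') ⟩
    w * ι b'                                       ≈⟨ solve-for w+wb'≈1 ⟩
    1# - w                                         ∎
    where
    w = ι b ⁻¹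
    L = applyUpTo suc b'
    term≈1 : ∀ j → ipow ξ (ℤ.+ j ℤ.* t) * 1# ≈ 1#
    term≈1 j = trans (*-identityʳ _)
                 (trans (ipow-*ˡ ξ j t) (trans (^-congˡ j (∣⇒ipow≈1 t b∣t)) (1^n≈1 j)))
    w+wb'≈1 : w + w * ι b' ≈ 1#
    w+wb'≈1 = trans (+-congʳ (sym (*-identityʳ w)))
                (trans (sym (distribˡ w 1# (ι b'))) (inverseˡ (ι b) (ι≉0 {b} (s≤s z≤n))))
  ... | no b∤t = begin
    w * Σ[ L ] (λ j → ipow ξ (ℤ.+ j ℤ.* t) * 1#)   ≈⟨ *-congˡ (Σ-cong L (λ j → trans (*-identityʳ _) (ipow-*ˡ ξ j t))) ⟩
    w * Σ[ L ] (ipow ξ t ^_)                       ≈⟨ *-congˡ (geometric-sum b' (ipow-root t) (b∤t ∘ ipow≈1⇒∣ t)) ⟩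
    w * - 1#                                       ≈⟨ sym (-‿distribʳ-* w 1#) ⟩
    - (w * 1#)                                     ≈⟨ -‿cong (*-identityʳ w) ⟩
    - w                                            ≈⟨ sym (+-identityˡ _) ⟩
    0# - w                                         ∎
    where
    w = ι b ⁻¹
    L = applyUpTo suc b'

module Averaging {c ℓ} (F : CharZeroField c ℓ) (ξ : CharZeroField.Carrier F) (b' : ℕ)
  (ξ-primitive : FourierDedekind.IsPrimitiveRoot F ξ (suc b')) (2≤b : 2 ≤ suc b') where
  open CharZeroField F hiding (zero)
  open FourierDedekind F
  open FieldFacts F
  open BigOperators F
  open RootsOfUnity F ξ b' ξ-primitive
  open SetoidReasoning setoid

  U : List ℕ
  U = unitsBelow b

  recip : ℕ → ℕ → Carrier
  recip j m = (1# - ξ ^ (j ℕ.* m)) ⁻¹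

  -- The residues m and b - m contribute 1 together, as ξ^{jm} ξ^{j(b-m)} = ξ^{jb} = 1.
  recip-pair : ∀ {j} → 1 ≤ j → j < b → ∀ m → m ≤ b → IsUnit b m →
               recip j m + recip j (b ∸ m) ≈ 1#
  recip-pair {j} 1≤j j<b m m≤b m-unit = reciprocal-pair product≈1
    (pow-coprime≉1 1≤j j<b (gcd≡1⇒coprime m-unit))
    (pow-coprime≉1 1≤j j<b (coprime-reflect m≤b (gcd≡1⇒coprime m-unit)))
    where
    product≈1 : ξ ^ (j ℕ.* m) * ξ ^ (j ℕ.* (b ∸ m)) ≈ 1#
    product≈1 = begin
      ξ ^ (j ℕ.* m) * ξ ^ (j ℕ.* (b ∸ m))   ≈⟨ sym (^-homo-* ξ (j ℕ.* m) (j ℕ.* (b ∸ m))) ⟩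
      ξ ^ (j ℕ.* m ℕ.+ j ℕ.* (b ∸ m))       ≈⟨ ^-congʳ ξ (≡.trans (≡.sym (ℕP.*-distribˡ-+ j m (b ∸ m)))
                                                                 (≡.cong (j ℕ.*_) (ℕP.m+[n∸m]≡n m≤b))) ⟩
      ξ ^ (j ℕ.* b)                         ≈⟨ ∣⇒pow≈1 (divides j ≡.refl) ⟩
      1#                                    ∎

  H : Carrier
  H = ι (φ b) * ι 2 ⁻¹

  ι2≉0 : ¬ ι 2 ≈ 0#
  ι2≉0 = ι≉0 {2} (s≤s z≤n)

  φ≉0 : ¬ ι (φ b) ≈ 0#
  φ≉0 = ι≉0 (φ-positive {b} (s≤s z≤n))

  -- Σ_{m ∈ U} 1/(1 - ξ^{jm}) = φ(b)/2 for 1 ≤ j < b, by pairing m with b - m.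
  unit-sum : ∀ {j} → 1 ≤ j → j < b → Σ[ U ] (recip j) ≈ H
  unit-sum {j} 1≤j j<b = begin
    Σ[ U ] (recip j)                     ≈⟨ sym (cancelˡ _ ι2≉0) ⟩
    ι 2 ⁻¹ * (ι 2 * Σ[ U ] (recip j))    ≈⟨ *-congˡ (Σ-reflection-pairing b' (unit? b) (recip j)
                                               unit-reflect
                                               (λ m _ m≤b' → recip-pair 1≤j j<b m (ℕP.m≤n⇒m≤1+n m≤b'))) ⟩
    ι 2 ⁻¹ * ι (length U)                ≡⟨ ≡.cong (λ n → ι 2 ⁻¹ * ι n) (≡.sym (φ≡length-unitsBelow 2≤b)) ⟩
    ι 2 ⁻¹ * ι (φ b)                     ≈⟨ *-comm _ _ ⟩
    H                                    ∎

  -- Summing S(cs, m₁, …, m_d) over all m₁, …, m_d ∈ U multiplies S(cs) by H^d: the inner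
  -- sum factors term by term into (Σ_{m ∈ U} 1/(1 - ξ^{jm}))^d = H^d, independently of j.
  average-tuples : ∀ d cs t → sumTuples U d (λ ms → S ξ (cs ++ ms) b t) ≈ H ^ d * S ξ cs b t
  average-tuples d cs t = begin
    sumTuples U d (λ ms → w * Σ[ L ] (λ j → e j * Π[ cs ++ ms ] (recip j)))
      ≈⟨ sumTuples-*ˡ U d w _ ⟩
    w * sumTuples U d (λ ms → Σ[ L ] (λ j → e j * Π[ cs ++ ms ] (recip j)))
      ≈⟨ *-congˡ (sumTuples-Σ U d L _) ⟩
    w * Σ[ L ] (λ j → sumTuples U d (λ ms → e j * Π[ cs ++ ms ] (recip j)))
      ≈⟨ *-congˡ (Σ-cong L (λ j → sumTuples-cong U d (λ ms →
           trans (*-congˡ (Π-++ cs ms (recip j))) (sym (*-assoc _ _ _))))) ⟩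
    w * Σ[ L ] (λ j → sumTuples U d (λ ms → a j * Π[ ms ] (recip j)))
      ≈⟨ *-congˡ (Σ-cong L (λ j → sumTuples-Π U d (a j) (recip j))) ⟩
    w * Σ[ L ] (λ j → a j * (Σ[ U ] (recip j)) ^ d)
      ≈⟨ *-congˡ (Σ-congᴬ (applyUpTo⁺₁ suc b' (λ i<b' →
           *-congˡ (^-congˡ d (unit-sum (s≤s z≤n) (s≤s i<b')))))) ⟩
    w * Σ[ L ] (λ j → a j * H ^ d)
      ≈⟨ *-congˡ (Σ-*ʳ L (H ^ d) a) ⟩
    w * (Σ[ L ] a * H ^ d)
      ≈⟨ *-Solver.solve 3 (λ w A Hᵈ → w ⊕ (A ⊕ Hᵈ) ⊜ Hᵈ ⊕ (w ⊕ A)) refl w (Σ[ L ] a) (H ^ d) ⟩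
    H ^ d * (w * Σ[ L ] a)
      ∎
    where
    open *-Solver using (_⊕_; _⊜_)
    w = ι b ⁻¹
    L = applyUpTo suc b'
    e : ℕ → Carrier
    e j = ipow ξ (ℤ.+ j ℤ.* t)
    a : ℕ → Carrier
    a j = e j * Π[ cs ] (recip j)

  average-last : ∀ cs t →
    ι (φ b) ⁻¹ * (Σ[ U ] λ m → S ξ (cs ++ m ∷ []) b t) ≈ ι 2 ⁻¹ * S ξ cs b t
  average-last cs t = begin
    ι (φ b) ⁻¹ * (Σ[ U ] λ m → S ξ (cs ++ m ∷ []) b t)   ≈⟨ *-congˡ (average-tuples 1 cs t) ⟩
    ι (φ b) ⁻¹ * ((ι (φ b) * ι 2 ⁻¹) * 1# * S ξ cs b t)  ≈⟨ *-congˡ (*-congʳ (*-identityʳ H)) ⟩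
    ι (φ b) ⁻¹ * ((ι (φ b) * ι 2 ⁻¹) * S ξ cs b t)       ≈⟨ *-congˡ (*-assoc _ _ _) ⟩
    ι (φ b) ⁻¹ * (ι (φ b) * (ι 2 ⁻¹ * S ξ cs b t))       ≈⟨ cancelˡ _ φ≉0 ⟩
    ι 2 ⁻¹ * S ξ cs b t                                  ∎

  average-all : ∀ d t →
    ι (φ b ^ℕ d) ⁻¹ * sumTuples U d (λ ms → S ξ ms b t) ≈ ι (2 ^ℕ d) ⁻¹ * S ξ [] b t
  average-all d t = begin
    ι (φ b ^ℕ d) ⁻¹ * sumTuples U d (λ ms → S ξ ms b t)      ≈⟨ *-congˡ (average-tuples d [] t) ⟩
    ι (φ b ^ℕ d) ⁻¹ * (H ^ d * S ξ [] b t)                   ≈⟨ *-congˡ (*-congʳ Hᵈ≈ratio) ⟩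
    ι (φ b ^ℕ d) ⁻¹ * ((ι (φ b ^ℕ d) * ι (2 ^ℕ d) ⁻¹) * S ξ [] b t)
                                                             ≈⟨ *-congˡ (*-assoc _ _ _) ⟩
    ι (φ b ^ℕ d) ⁻¹ * (ι (φ b ^ℕ d) * (ι (2 ^ℕ d) ⁻¹ * S ξ [] b t))
                                                             ≈⟨ cancelˡ _ φᵈ≉0 ⟩
    ι (2 ^ℕ d) ⁻¹ * S ξ [] b t                               ∎
    where
    φᵈ≉0 : ¬ ι (φ b ^ℕ d) ≈ 0#
    φᵈ≉0 = ^≉0 d φ≉0 ∘ trans (sym (ι-homo-^ (φ b) d))
    Hᵈ≈ratio : H ^ d ≈ ι (φ b ^ℕ d) * ι (2 ^ℕ d) ⁻¹
    Hᵈ≈ratio = begin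
      (ι (φ b) * ι 2 ⁻¹) ^ d          ≈⟨ ^-distrib-* (ι (φ b)) (ι 2 ⁻¹) d ⟩
      ι (φ b) ^ d * (ι 2 ⁻¹) ^ d      ≈⟨ *-cong (sym (ι-homo-^ (φ b) d)) (inverse-^ d ι2≉0) ⟩
      ι (φ b ^ℕ d) * (ι 2 ^ d) ⁻¹     ≈⟨ *-congˡ (⁻¹-cong (^≉0 d ι2≉0) (sym (ι-homo-^ 2 d))) ⟩
      ι (φ b ^ℕ d) * ι (2 ^ℕ d) ⁻¹    ∎

theorem28 : ∀ {c ℓ} (F : CharZeroField c ℓ) →
  let open CharZeroField F
      open FourierDedekind F
  in (ξ : Carrier) (b : ℕ) → IsPrimitiveRoot ξ b → 3 ≤ b →
     (n : ℕ) (as : Vec ℕ n) → All (λ a → 1 ≤ a × Coprime a b) as →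
     (t : ℤ) →
     ((ι (φ b) ⁻¹ * (Σ[ unitsBelow b ] λ m → S ξ (toList as ++ (m ∷ [])) b t))
        ≈ ((ι 2 ⁻¹) * S ξ (toList as) b t))
     × (((ι (φ b ^ℕ suc n) ⁻¹) * sumTuples (unitsBelow b) (suc n) (λ ms → S ξ ms b t))
        ≈ ((ι (2 ^ℕ suc n) ⁻¹) * S ξ [] b t))
     × (((ι (2 ^ℕ suc n) ⁻¹) * S ξ [] b t)
        ≈ ((ι (2 ^ℕ suc n) ⁻¹) * (δℤ t b - ι b ⁻¹)))
theorem28 F ξ (suc b') ξ-primitive (s≤s 2≤b') n as _ t =
  average-last (toList as) t , average-all (suc n) t , *-congˡ (S-empty t)
  where
  open CharZeroField F using (*-congˡ)
  open Averaging F ξ b' ξ-primitive (ℕP.m≤n⇒m≤1+n 2≤b')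
  open RootsOfUnity F ξ b' ξ-primitive using (S-empty)
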